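{- For every instance of the stable matching problem with one-sided uncertainty (with $|A|=|B|=n$), the minimum number of interview queries needed to verify that the $B$-optimal stable matching is stable and $B$-optimal is at least $n-1$.
   Context: Two disjoint sets $A$, $B$ of agents with $|A|=|B|=n$. Each $a\in A$ has a strict total order $\prec_a$ on $B$ and each $b\in B$ has a strict total order $\prec_b$ on $A$ ($x\prec_y z$: $y$ prefers $x$ to $z$). A matching is a bijection between $A$ and $B$; it is stable if there is no pair $(a,b)$, $b\neq M(a)$, with $a$ preferring $b$ to $M(a)$ and $b$ preferring $a$ to $M(b)$. A stable matching is $B$-optimal if every agent of $B$ weakly prefers its partner in it to its partner in any other stable matching. One-sided uncertainty: the orders $\prec_a$ ($a\in A$) are known, the orders $\prec_b$ ($b\in B$) are unknown and learned only via queries. An interview query $\mathit{intq}(b,a)$ for $b\in B$, $a\in A$ reveals the restriction of $\prec_b$ to $\{a\}\cup P_b$, where $P_b$ is the set of all $a'\in A$ for which $\mathit{intq}(b,a')$ was executed before. A query set verifies the property if for every $B$-side preference profile consistent with the $A$-side preferences and the revealed information, the matching is stable and $B$-optimal. -}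

module Defs where

open import Data.Nat using (ℕ; _<_; _≤_)
open import Data.Fin using (Fin)
open import Data.Product using (Σ; _×_; _,_; proj₁)
open import Data.List using (List)
open import Data.List.Membership.Propositional using (_∈_)
open import Relation.Binary.PropositionalEquality using (_≡_; _≢_)
open import Relation.Nullary using (¬_)
open import Function.Definitions using (Injective)

-- A strict total order on a set of n agents (Fin n), given by an injective
-- rank function: x is preferred to z  iff  rank x < rank z.
Pref : ℕ → Set
Pref n = Σ (Fin n → ℕ) (Injective _≡_ _≡_)

rank : ∀ {n} → Pref n → Fin n → ℕ
rank = proj₁

_⊢_≺_ : ∀ {n} → Pref n → Fin n → Fin n → Set
p ⊢ x ≺ z = rank p x < rank p z

_⊢_⪯_ : ∀ {n} → Pref n → Fin n → Fin n → Set
p ⊢ x ⪯ z = rank p x ≤ rank p z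

Profile : ℕ → Set
Profile n = Fin n → Pref n

-- A matching: a bijection A → B (injective self-map of Fin n).
Matching : ℕ → Set
Matching n = Σ (Fin n → Fin n) (Injective _≡_ _≡_)

partner : ∀ {n} → Matching n → Fin n → Fin n
partner = proj₁

Stable : ∀ {n} → Profile n → Profile n → Matching n → Set
Stable pA pB M = ∀ a b → b ≢ partner M a → ∀ a' → partner M a' ≡ b →
  ¬ ((pA a ⊢ b ≺ partner M a) × (pB b ⊢ a ≺ a'))

BOptimal : ∀ {n} → Profile n → Profile n → Matching n → Set
BOptimal {n} pA pB M = ∀ (M' : Matching n) → Stable pA pB M' →
  ∀ b a a' → partner M a ≡ b → partner M' a' ≡ b → pB b ⊢ a ⪯ a'

-- A query sequence: a list of interview queries intq(b,a), written (b , a).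
Queries : ℕ → Set
Queries n = List (Fin n × Fin n)

Queried : ∀ {n} → Queries n → Fin n → Fin n → Set
Queried Q b a = (b , a) ∈ Q

AgreeOn : ∀ {n} → (Fin n → Set) → Pref n → Pref n → Set
AgreeOn S p p' = ∀ x z → S x → S z → ((p ⊢ x ≺ z → p' ⊢ x ≺ z) × (p' ⊢ x ≺ z → p ⊢ x ≺ z))

-- Consistency with the revealed information: after all queries, the revealed
-- information for b is the restriction of ≺_b to the set of queried a's.
Consistent : ∀ {n} → Queries n → Profile n → Profile n → Set
Consistent Q pB pB' = ∀ b → AgreeOn (Queried Q b) (pB b) (pB' b)

Verifies : ∀ {n} → Profile n → Profile n → Matching n → Queries n → Set
Verifies pA pB M Q = ∀ (pB' : Profile _) → Consistent Q pB pB' →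
  Stable pA pB' M × BOptimal pA pB' M

-- With fewer than n − 1 interview queries, two agents b₁ ≠ b₂ of B never
-- interviewed their own partner M⁻¹(b).  Moving that partner to the bottom
-- of b's order is consistent with everything revealed, and afterwards every
-- a ∈ A is desired by b₁ or b₂, i.e. preferred by them to their partner.
-- But a stable matching in which every a is desired by someone is never
-- B-optimal: the map sending a to the partner of its favourite desirer has a
-- cycle, and letting each a on that cycle switch to its favourite desirer
-- gives a stable matching that some b strictly prefers.
module Submission where

open import Defs
open import Data.Nat using (ℕ; _≤_; _∸_)
open import Data.List using (length)

open import Data.Nat using (zero; suc; _+_; _<_; z≤n; s≤s)
open import Data.Nat.Properties
  using (≤-reflexive; ≤-pred; <-irrefl; <-≤-trans; <⇒≤; <⇒≱; ≤∧≢⇒<; 1+n≰n;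
         +-comm; +-suc; n<1+n; m≤n⇒∃[o]m+o≡n; _<?_; _≤?_)
import Data.Nat.Properties as ℕ
import Data.Fin as Fin
open import Data.Fin using (Fin; toℕ; fromℕ<; punchIn; punchOut)
open import Data.Fin.Properties
  using (_≟_; any?; pigeonhole; injective⇒≤; toℕ<n; toℕ-fromℕ<;
         punchIn-injective; punchInᵢ≢i; punchOut-injective)
open import Data.Product using (∃; ∃₂; _×_; _,_; proj₁; proj₂)
open import Data.Product.Properties using (≡-dec)
open import Data.List using (List; lookup; map; filter; allFin)
open import Data.List.Extrema.Nat using (max; xs≤max; argmin; argmin-all; f[argmin]≤f[xs])
open import Data.List.Membership.Propositional using (_∈_)
open import Data.List.Membership.Propositional.Properties using (∈-map⁺; ∈-filter⁺; ∈-allFin)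
import Data.List.Membership.DecPropositional as DecMembership
import Data.List.Relation.Unary.All as All
open import Data.List.Relation.Unary.All.Properties using (all-filter)
open import Data.List.Relation.Unary.Any using (index)
open import Data.List.Relation.Unary.Any.Properties using (lookup-index)
open import Function using (_∘_)
open import Function.Definitions using (Injective)
open import Relation.Binary.Definitions using (DecidableEquality)
open import Relation.Binary.PropositionalEquality
open import Relation.Nullary using (¬_; Dec; yes; no; contradiction)
open import Relation.Nullary.Decidable using (_×-dec_; ¬?; decidable-stable)
import Relation.Unary as Unary

injective⇒preimage : ∀ {n} {f : Fin n → Fin n} → Injective _≡_ _≡_ f →
                     ∀ y → ∃ λ x → f x ≡ y
injective⇒preimage {suc m} {f} f-inj y with any? (λ x → f x ≟ y)
... | yes found = found
... | no ¬found = contradiction (injective⇒≤ punchOut∘f-injective) 1+n≰n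
  where
  y≢f : ∀ x → y ≢ f x
  y≢f x y≡fx = ¬found (x , sym y≡fx)
  punchOut∘f-injective : Injective _≡_ _≡_ (λ x → punchOut (y≢f x))
  punchOut∘f-injective {x} {x′} eq = f-inj (punchOut-injective (y≢f x) (y≢f x′) eq)

injective-⊆⇒≤length : ∀ {k} {A : Set} {xs : List A} (h : Fin k → A) →
                      Injective _≡_ _≡_ h → (∀ i → h i ∈ xs) → k ≤ length xs
injective-⊆⇒≤length {xs = xs} h h-inj h∈xs = injective⇒≤ index-injective
  where
  index-injective : Injective _≡_ _≡_ (λ i → index (h∈xs i))
  index-injective {i} {j} eq = h-inj (begin
    h i                        ≡⟨ lookup-index (h∈xs i) ⟩
    lookup xs (index (h∈xs i)) ≡⟨ cong (lookup xs) eq ⟩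
    lookup xs (index (h∈xs j)) ≡⟨ lookup-index (h∈xs j) ⟨
    h j                        ∎)
    where open ≡-Reasoning

module Orbit {A : Set} (g : A → A) where

  open import Function.Endo.Propositional A public using (_^_)
  open import Function.Endo.Propositional A using (^-homo)

  ^-+ : ∀ k l x → (g ^ (k + l)) x ≡ (g ^ k) ((g ^ l) x)
  ^-+ k l = cong-app (^-homo g k l)

  periodicPoint : ∀ {n} {ι : A → Fin n} → Injective _≡_ _≡_ ι →
                  A → ∃₂ λ c o → (g ^ suc o) c ≡ c
  periodicPoint {n} {ι} ι-inj x
    with i , j , i<j , same ← pigeonhole (n<1+n n) (λ k → ι ((g ^ toℕ k) x))
    with o , i+1+o≡j ← m≤n⇒∃[o]m+o≡n i<j
    = (g ^ toℕ i) x , o , (begin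
      (g ^ suc o) ((g ^ toℕ i) x) ≡⟨ ^-+ (suc o) (toℕ i) x ⟨
      (g ^ (suc o + toℕ i)) x     ≡⟨ cong (λ k → (g ^ k) x) o+1+i≡j ⟩
      (g ^ toℕ j) x               ≡⟨ ι-inj same ⟨
      (g ^ toℕ i) x               ∎)
    where
    open ≡-Reasoning
    o+1+i≡j : suc o + toℕ i ≡ toℕ j
    o+1+i≡j = trans (cong suc (+-comm o (toℕ i))) i+1+o≡j

  module Cycle (_≟ᴬ_ : DecidableEquality A) {c : A} {o : ℕ}
               (period : (g ^ suc o) c ≡ c) where

    OnCycle : A → Set
    OnCycle a = ∃ λ (t : Fin (suc o)) → (g ^ toℕ t) c ≡ a

    onCycle? : Unary.Decidable OnCycle
    onCycle? a = any? (λ t → (g ^ toℕ t) c ≟ᴬ a)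

    onCycle-start : OnCycle c
    onCycle-start = Fin.zero , refl

    onCycle-step : ∀ {a} → OnCycle a → OnCycle (g a)
    onCycle-step {a} (t , gᵗc≡a) with toℕ t ℕ.≟ o
    ... | yes t≡o = Fin.zero , trans (sym period)
                      (cong g (trans (cong (λ k → (g ^ k) c) (sym t≡o)) gᵗc≡a))
    ... | no t≢o = fromℕ< t+1<o+1 ,
                   trans (cong (λ k → (g ^ k) c) (toℕ-fromℕ< t+1<o+1)) (cong g gᵗc≡a)
      where
      t+1<o+1 : suc (toℕ t) < suc o
      t+1<o+1 = s≤s (≤∧≢⇒< (≤-pred (toℕ<n t)) t≢o)

    ^o-inverseOnCycle : ∀ {a} → OnCycle a → (g ^ o) (g a) ≡ a
    ^o-inverseOnCycle {a} (t , gᵗc≡a) = begin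
      (g ^ o) (g a)                   ≡⟨ cong ((g ^ o) ∘ g) gᵗc≡a ⟨
      (g ^ o) ((g ^ suc (toℕ t)) c)   ≡⟨ ^-+ o (suc (toℕ t)) c ⟨
      (g ^ (o + suc (toℕ t))) c       ≡⟨ cong (λ k → (g ^ k) c) o+1+t≡t+1+o ⟩
      (g ^ (toℕ t + suc o)) c         ≡⟨ ^-+ (toℕ t) (suc o) c ⟩
      (g ^ toℕ t) ((g ^ suc o) c)     ≡⟨ cong (g ^ toℕ t) period ⟩
      (g ^ toℕ t) c                   ≡⟨ gᵗc≡a ⟩
      a                               ∎
      where
      open ≡-Reasoning
      o+1+t≡t+1+o : o + suc (toℕ t) ≡ toℕ t + suc o
      o+1+t≡t+1+o = trans (+-comm o (suc (toℕ t))) (sym (+-suc (toℕ t) o))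

    injectiveOnCycle : ∀ {a a′} → OnCycle a → OnCycle a′ → g a ≡ g a′ → a ≡ a′
    injectiveOnCycle {a} {a′} on on′ eq = begin
      a              ≡⟨ ^o-inverseOnCycle on ⟨
      (g ^ o) (g a)  ≡⟨ cong (g ^ o) eq ⟩
      (g ^ o) (g a′) ≡⟨ ^o-inverseOnCycle on′ ⟩
      a′             ∎
      where open ≡-Reasoning

module _ {n : ℕ} where

  bottomRank : Pref n → ℕ
  bottomRank p = suc (max 0 (map (rank p) (allFin n)))

  rank<bottomRank : ∀ p x → rank p x < bottomRank p
  rank<bottomRank p x =
    s≤s (All.lookup (xs≤max 0 _) (∈-map⁺ (rank p) (∈-allFin x)))

  demotedRank : Fin n → Pref n → Fin n → ℕ
  demotedRank x p y with y ≟ x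
  ... | yes _ = bottomRank p
  ... | no  _ = rank p y

  demotedRank-≢ : ∀ x p {y} → y ≢ x → demotedRank x p y ≡ rank p y
  demotedRank-≢ x p {y} y≢x with y ≟ x
  ... | yes y≡x = contradiction y≡x y≢x
  ... | no  _   = refl

  demotedRank-≡ : ∀ x p → demotedRank x p x ≡ bottomRank p
  demotedRank-≡ x p with x ≟ x
  ... | yes _   = refl
  ... | no  x≢x = contradiction refl x≢x

  demotedRank-injective : ∀ x p → Injective _≡_ _≡_ (demotedRank x p)
  demotedRank-injective x p {y} {z} eq with y ≟ x | z ≟ x
  ... | yes y≡x | yes z≡x = trans y≡x (sym z≡x)
  ... | yes _   | no  _   = contradiction (sym eq) (λ e → <-irrefl e (rank<bottomRank p z))
  ... | no  _   | yes _   = contradiction eq (λ e → <-irrefl e (rank<bottomRank p y))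
  ... | no  _   | no  _   = proj₂ p eq

  demote : Fin n → Pref n → Pref n
  demote x p = demotedRank x p , demotedRank-injective x p

  demote-last : ∀ x p {y} → y ≢ x → demote x p ⊢ y ≺ x
  demote-last x p {y} y≢x =
    subst₂ _<_ (sym (demotedRank-≢ x p y≢x)) (sym (demotedRank-≡ x p)) (rank<bottomRank p y)

  demote-agrees : ∀ x p → AgreeOn (_≢ x) p (demote x p)
  demote-agrees x p y z y≢x z≢x =
    subst₂ _<_ (sym (demotedRank-≢ x p y≢x)) (sym (demotedRank-≢ x p z≢x)) ,
    subst₂ _<_ (demotedRank-≢ x p y≢x) (demotedRank-≢ x p z≢x)

  AgreeOn-refl : ∀ {S : Fin n → Set} p → AgreeOn S p p
  AgreeOn-refl p _ _ _ _ = (λ y≺z → y≺z) , (λ y≺z → y≺z)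

  partner⁻¹ : Matching n → Fin n → Fin n
  partner⁻¹ M b = proj₁ (injective⇒preimage (proj₂ M) b)

  partner-partner⁻¹ : ∀ M b → partner M (partner⁻¹ M b) ≡ b
  partner-partner⁻¹ M b = proj₂ (injective⇒preimage (proj₂ M) b)

  partner⁻¹-partner : ∀ M a → partner⁻¹ M (partner M a) ≡ a
  partner⁻¹-partner M a = proj₂ M (partner-partner⁻¹ M (partner M a))

  partner⁻¹-injective : ∀ M → Injective _≡_ _≡_ (partner⁻¹ M)
  partner⁻¹-injective M {b} {b′} eq = begin
    b                          ≡⟨ partner-partner⁻¹ M b ⟨
    partner M (partner⁻¹ M b)  ≡⟨ cong (partner M) eq ⟩
    partner M (partner⁻¹ M b′) ≡⟨ partner-partner⁻¹ M b′ ⟩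
    b′                         ∎
    where open ≡-Reasoning

  Desires : Profile n → Matching n → Fin n → Fin n → Set
  Desires pB M b a = pB b ⊢ a ≺ partner⁻¹ M b

  desires? : ∀ pB M a → Unary.Decidable (λ b → Desires pB M b a)
  desires? pB M a b = rank (pB b) a <? rank (pB b) (partner⁻¹ M b)

module Rotation {n} (pA pB : Profile n) (M : Matching n) (M-stable : Stable pA pB M)
                (desired : ∀ a → ∃ λ b → Desires pB M b a) where

  stable⇒¬blocking : ∀ {a b} → Desires pB M b a → ¬ (pA a ⊢ b ≺ partner M a)
  stable⇒¬blocking {a} {b} b-desires-a b≺Ma =
    M-stable a b (λ b≡Ma → <-irrefl (cong (rank (pA a)) b≡Ma) b≺Ma)
      (partner⁻¹ M b) (partner-partner⁻¹ M b) (b≺Ma , b-desires-a)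

  desirers : Fin n → List (Fin n)
  desirers a = filter (desires? pB M a) (allFin n)

  favourite : Fin n → Fin n
  favourite a = argmin (rank (pA a)) (proj₁ (desired a)) (desirers a)

  favourite-desires : ∀ a → Desires pB M (favourite a) a
  favourite-desires a =
    argmin-all (rank (pA a)) (proj₂ (desired a)) (all-filter (desires? pB M a) (allFin n))

  favourite-best : ∀ a {b} → Desires pB M b a → pA a ⊢ favourite a ⪯ b
  favourite-best a {b} b-desires-a = All.lookup (f[argmin]≤f[xs] _ (desirers a))
    (∈-filter⁺ (desires? pB M a) (∈-allFin b) b-desires-a)

  next : Fin n → Fin n
  next a = partner⁻¹ M (favourite a)

  open Orbit next

  module Rotate {c o} (period : (next ^ suc o) c ≡ c) where

    open Cycle _≟_ {c} {o} period

    rotatedPartner : ∀ a → Dec (OnCycle a) → Fin n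
    rotatedPartner a (yes _) = favourite a
    rotatedPartner a (no  _) = partner M a

    rotatedPartner-onCycle : ∀ {a} d → OnCycle a → rotatedPartner a d ≡ favourite a
    rotatedPartner-onCycle (yes _)  _  = refl
    rotatedPartner-onCycle (no ¬on) on = contradiction on ¬on

    leaves-cycle : ∀ {a a′} → OnCycle a → ¬ OnCycle a′ → favourite a ≢ partner M a′
    leaves-cycle {a} {a′} on ¬on′ fav≡Ma′ =
      ¬on′ (subst OnCycle (trans (cong (partner⁻¹ M) fav≡Ma′) (partner⁻¹-partner M a′))
                          (onCycle-step on))

    rotatedPartner-injective : ∀ {a a′} d d′ →
                               rotatedPartner a d ≡ rotatedPartner a′ d′ → a ≡ a′
    rotatedPartner-injective (yes on) (yes on′) eq =
      injectiveOnCycle on on′ (cong (partner⁻¹ M) eq)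
    rotatedPartner-injective (yes on) (no ¬on′) eq = contradiction eq (leaves-cycle on ¬on′)
    rotatedPartner-injective (no ¬on) (yes on′) eq = contradiction (sym eq) (leaves-cycle on′ ¬on)
    rotatedPartner-injective (no _)   (no _)    eq = proj₂ M eq

    rotated : Matching n
    rotated = (λ a → rotatedPartner a (onCycle? a)) ,
              (λ {a} {a′} → rotatedPartner-injective (onCycle? a) (onCycle? a′))

    rotatedPartner-⪯ : ∀ {a b} d → rotatedPartner a d ≡ b → pB b ⊢ a ⪯ partner⁻¹ M b
    rotatedPartner-⪯ {a} (yes _) refl = <⇒≤ (favourite-desires a)
    rotatedPartner-⪯ {a} (no _)  refl =
      ≤-reflexive (cong (rank (pB (partner M a))) (sym (partner⁻¹-partner M a)))

    rotatedPartner-¬blocking : ∀ {a b} d → Desires pB M b a → ¬ (pA a ⊢ b ≺ rotatedPartner a d)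
    rotatedPartner-¬blocking {a} {b} (yes _) b-desires-a b≺fav =
      <⇒≱ b≺fav (favourite-best a {b} b-desires-a)
    rotatedPartner-¬blocking {a} {b} (no _)  b-desires-a =
      stable⇒¬blocking {a} {b} b-desires-a

    rotated-stable : Stable pA pB rotated
    rotated-stable a b _ a′ a′↦b (b≺a , a≺a′) =
      rotatedPartner-¬blocking (onCycle? a)
        (<-≤-trans a≺a′ (rotatedPartner-⪯ (onCycle? a′) a′↦b)) b≺a

    -- favourite c gets c in the rotated matching, whom it prefers to its partner next c.
    ¬BOptimal : ¬ BOptimal pA pB M
    ¬BOptimal optimal = <⇒≱ (favourite-desires c)
      (optimal rotated rotated-stable (favourite c) (next c) c
        (partner-partner⁻¹ M (favourite c)) (rotatedPartner-onCycle (onCycle? c) onCycle-start))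

  ¬BOptimal : Fin n → ¬ BOptimal pA pB M
  ¬BOptimal a₀ with c , o , period ← periodicPoint (λ eq → eq) a₀ =
    Rotate.¬BOptimal {c} {o} period

desiredEverywhere⇒¬BOptimal : ∀ {n} (pA pB : Profile (suc n)) M → Stable pA pB M →
                               (∀ a → ∃ λ b → Desires pB M b a) → ¬ BOptimal pA pB M
desiredEverywhere⇒¬BOptimal pA pB M stable desired =
  Rotation.¬BOptimal pA pB M stable desired Fin.zero

module _ {n : ℕ} (M : Matching n) (Q : Queries n) where

  queried? : ∀ b a → Dec (Queried Q b a)
  queried? b a = (b , a) ∈? Q
    where open DecMembership (≡-dec _≟_ _≟_) using (_∈?_)

  Unqueried : Fin n → Set
  Unqueried b = ¬ Queried Q b (partner⁻¹ M b)

  module _ (pB : Profile n) where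

    demoteIfUnqueried : ∀ b → Dec (Queried Q b (partner⁻¹ M b)) → Pref n
    demoteIfUnqueried b (yes _) = pB b
    demoteIfUnqueried b (no  _) = demote (partner⁻¹ M b) (pB b)

    demoteUnqueried : Profile n
    demoteUnqueried b = demoteIfUnqueried b (queried? b (partner⁻¹ M b))

    demoteIfUnqueried-agrees : ∀ b d → AgreeOn (Queried Q b) (pB b) (demoteIfUnqueried b d)
    demoteIfUnqueried-agrees b (yes _) = AgreeOn-refl (pB b)
    demoteIfUnqueried-agrees b (no ¬q) x z qx qz =
      demote-agrees (partner⁻¹ M b) (pB b) x z (queried⇒≢ x qx) (queried⇒≢ z qz)
      where
      queried⇒≢ : ∀ a → Queried Q b a → a ≢ partner⁻¹ M b
      queried⇒≢ a q refl = ¬q q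

    demoteUnqueried-consistent : Consistent Q pB demoteUnqueried
    demoteUnqueried-consistent b = demoteIfUnqueried-agrees b (queried? b (partner⁻¹ M b))

    demoteIfUnqueried-last : ∀ b d → Unqueried b → ∀ {a} → a ≢ partner⁻¹ M b →
                             demoteIfUnqueried b d ⊢ a ≺ partner⁻¹ M b
    demoteIfUnqueried-last b (yes q) ¬q = contradiction q ¬q
    demoteIfUnqueried-last b (no  _) _  = demote-last _ (pB b)

    unqueried⇒desires : ∀ {b} → Unqueried b → ∀ {a} → a ≢ partner⁻¹ M b →
                        Desires demoteUnqueried M b a
    unqueried⇒desires {b} = demoteIfUnqueried-last b (queried? b (partner⁻¹ M b))

    twoUnqueried⇒desiredEverywhere : ∀ {b₁ b₂} → b₁ ≢ b₂ → Unqueried b₁ → Unqueried b₂ →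
                                     ∀ a → ∃ λ b → Desires demoteUnqueried M b a
    twoUnqueried⇒desiredEverywhere {b₁} {b₂} b₁≢b₂ u₁ u₂ a with a ≟ partner⁻¹ M b₁
    ... | no  a≢b₁′ = b₁ , unqueried⇒desires u₁ a≢b₁′
    ... | yes a≡b₁′ = b₂ , unqueried⇒desires u₂
                             (λ a≡b₂′ → b₁≢b₂ (partner⁻¹-injective M (trans (sym a≡b₁′) a≡b₂′)))

module _ {m : ℕ} (M : Matching (suc m)) (Q : Queries (suc m)) where

  queriedAllBut⇒≤length : ∀ b₀ → (∀ b → b ≢ b₀ → ¬ Unqueried M Q b) → m ≤ length Q
  queriedAllBut⇒≤length b₀ queried = injective-⊆⇒≤length
    (λ k → punchIn b₀ k , partner⁻¹ M (punchIn b₀ k))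
    (λ eq → punchIn-injective b₀ _ _ (cong proj₁ eq))
    (λ k → decidable-stable (queried? M Q _ _) (queried (punchIn b₀ k) (punchInᵢ≢i b₀ k)))

  fewQueries⇒twoUnqueried : ¬ (m ≤ length Q) →
                            ∃₂ λ b₁ b₂ → b₁ ≢ b₂ × Unqueried M Q b₁ × Unqueried M Q b₂
  fewQueries⇒twoUnqueried few with any? (λ b → ¬? (queried? M Q b (partner⁻¹ M b)))
  ... | no none = contradiction (queriedAllBut⇒≤length Fin.zero (λ b _ u → none (b , u))) few
  ... | yes (b₁ , u₁) with any? (λ b → ¬? (b ≟ b₁) ×-dec ¬? (queried? M Q b (partner⁻¹ M b)))
  ...   | yes (b₂ , b₂≢b₁ , u₂) = b₁ , b₂ , b₂≢b₁ ∘ sym , u₁ , u₂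
  ...   | no  none = contradiction
                       (queriedAllBut⇒≤length b₁ (λ b b≢b₁ u → none (b , b≢b₁ , u))) few

lemma18 : (n : ℕ) (pA pB : Profile n) (M : Matching n) →
          Stable pA pB M → BOptimal pA pB M →
          (Q : Queries n) → Verifies pA pB M Q → n ∸ 1 ≤ length Q
lemma18 zero    _  _  _ _ _ _ _ = z≤n
lemma18 (suc m) pA pB M _ _ Q verifies with m ≤? length Q
... | yes enough = enough
... | no  few
  with b₁ , b₂ , b₁≢b₂ , u₁ , u₂ ← fewQueries⇒twoUnqueried M Q few
  with stable , optimal ← verifies (demoteUnqueried M Q pB) (demoteUnqueried-consistent M Q pB)
  = contradiction optimal
      (desiredEverywhere⇒¬BOptimal pA (demoteUnqueried M Q pB) M stable
        (twoUnqueried⇒desiredEverywhere M Q pB b₁≢b₂ u₁ u₂))
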